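{- Let $q$ be a prime power, fix $\delta\in\{0,1\}$, $m\geq1$ and $0\leq r<m$. There is a polynomial $h(x)\in\mathbb Z[x]$ of degree at most $4m-2-\delta$ such that \[ \sum_{k\geq0,\ k\equiv\delta\ (\mathrm{mod}\ 2)}f_{r,m,k}\,x^k=\frac{h(x)}{(1+qx^2)^{2m}-x^{2m}}. \]
   Context: For integers $r$, $m\geq1$, $k\geq0$: $f_{r,m,k}=\sum_{0\leq j\leq\lfloor k/2\rfloor,\ j\equiv\lfloor k/2\rfloor-r\ (\mathrm{mod}\ m)}\binom{k-j}{j}(-q)^j$. -}

module Defs where

open import Data.Nat as ℕ using (ℕ; zero; suc; _∸_; ⌊_/2⌋; _≤_; _<_)
open import Data.Nat.Combinatorics using (_C_)
open import Data.Nat.Divisibility using (_∣?_)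
open import Data.Nat.Primality using (Prime)
open import Data.Integer as ℤ using (ℤ; +_; -_; _-_; _+_; _*_; _^_; ∣_∣)
open import Data.Product using (∃; _×_)
open import Relation.Nullary.Decidable using (does)
open import Data.Bool using (if_then_else_)
open import Relation.Binary.PropositionalEquality using (_≡_)

IsPrimePower : ℕ → Set
IsPrimePower q = ∃ λ p → ∃ λ e → Prime p × 1 ≤ e × q ≡ p ℕ.^ e

Σ≤ : ℕ → (ℕ → ℤ) → ℤ
Σ≤ zero    g = g 0
Σ≤ (suc n) g = Σ≤ n g + g (suc n)

-- f_{r,m,k} = Σ_{0 ≤ j ≤ ⌊k/2⌋, j ≡ ⌊k/2⌋ - r (mod m)} binom(k-j, j) (-q)^j
-- (the congruence is taken in ℤ:  m ∣ (⌊k/2⌋ - r - j))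
f : (q r m k : ℕ) → ℤ
f q r m k = Σ≤ ⌊ k /2⌋ λ j →
  if does (m ∣? ∣ + ⌊ k /2⌋ - + r - + j ∣)
  then + ((k ∸ j) C j) * ((- (+ q)) ^ j)
  else + 0

Series : Set
Series = ℕ → ℤ

_⊛_ : Series → Series → Series
(a ⊛ b) n = Σ≤ n λ i → a i * b (n ∸ i)

_⊕_ : Series → Series → Series
(a ⊕ b) n = a n + b n

_⊖_ : Series → Series → Series
(a ⊖ b) n = a n - b n

one : Series
one zero    = + 1
one (suc _) = + 0

mono : ℤ → ℕ → Series
mono c d n = if does (n ℕ.≟ d) then c else + 0

_^ˢ_ : Series → ℕ → Series
a ^ˢ zero  = one
a ^ˢ suc n = a ⊛ (a ^ˢ n)

denom : (q m : ℕ) → Series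
denom q m = ((one ⊕ mono (+ q) 2) ^ˢ (2 ℕ.* m)) ⊖ mono (+ 1) (2 ℕ.* m)

genF : (q r m δ : ℕ) → Series
genF q r m δ k = if does ((k ℕ.% 2) ℕ.≟ δ) then f q r m k else + 0

PolyDeg≤ : Series → ℕ → Set
PolyDeg≤ h d = ∀ n → d < n → h n ≡ + 0

-- Replace ⌊k/2⌋ in the congruence defining f_{r,m,k} by a free offset T, obtaining f′ k T.
-- Pascal's rule gives f′ (k+2) (T+1) = f′ (k+1) (T+1) - q f′ k T, and f′ is m-periodic in T.
-- Let F_a be the series of f′ k (⌊k/2⌋ + a) over k ≡ δ (mod 2). Three Pascal steps show that
-- (1 + q x²)² F_a and x² F_{a+1} agree in every degree above 2 - δ. Iterating m times,
-- (1 + q x²)^{2m} F_0 agrees with x^{2m} F_m = x^{2m} F_0 above 4m - 2 - δ, so multiplying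
-- F_0 by (1 + q x²)^{2m} - x^{2m} leaves a polynomial of degree at most 4m - 2 - δ.
module Submission where

open import Defs
open import Data.Bool using (Bool; true; false; if_then_else_)
open import Data.Integer as ℤ using (ℤ; +_; -_; _+_; _-_; _*_; _^_; ∣_∣)
import Data.Integer.Divisibility.Signed as ℤ∣
import Data.Integer.Properties as ℤₚ
open import Data.Integer.Tactic.RingSolver using (solve-∀)
open import Data.Nat as ℕ using (ℕ; zero; suc; _∸_; _≤_; _<_; _≤′_; ≤′-refl; ≤′-step; z≤n; s≤s; ⌊_/2⌋; _%_)
open import Data.Nat.Combinatorics using (_C_; nCk+nC[k+1]≡[n+1]C[k+1]; k>n⇒nCk≡0)
open import Data.Nat.Divisibility using (_∣?_)
import Data.Nat.Properties as ℕₚ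
open import Data.Product using (∃; _×_; _,_)
open import Function.Base using (_∘_)
open import Function.Bundles using (mk⇔)
open import Relation.Binary.PropositionalEquality
open import Relation.Nullary.Decidable using (does; yes; no; dec-true; dec-false; does-⇔)
open import Relation.Nullary.Negation using (¬_)

Σ≤-cong : ∀ n {g h : ℕ → ℤ} → (∀ i → i ≤ n → g i ≡ h i) → Σ≤ n g ≡ Σ≤ n h
Σ≤-cong zero    g≡h = g≡h 0 z≤n
Σ≤-cong (suc n) g≡h =
  cong₂ _+_ (Σ≤-cong n λ i i≤n → g≡h i (ℕₚ.m≤n⇒m≤1+n i≤n)) (g≡h (suc n) ℕₚ.≤-refl)

Σ≤-+ : ∀ n (g h : ℕ → ℤ) → Σ≤ n (λ i → g i + h i) ≡ Σ≤ n g + Σ≤ n h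
Σ≤-+ zero    g h = refl
Σ≤-+ (suc n) g h = trans (cong (_+ (g (suc n) + h (suc n))) (Σ≤-+ n g h))
  (interchange (Σ≤ n g) (Σ≤ n h) (g (suc n)) (h (suc n)))
  where
  interchange : ∀ a b c d → a + b + (c + d) ≡ a + c + (b + d)
  interchange = solve-∀

Σ≤-- : ∀ n (g h : ℕ → ℤ) → Σ≤ n (λ i → g i - h i) ≡ Σ≤ n g - Σ≤ n h
Σ≤-- zero    g h = refl
Σ≤-- (suc n) g h = trans (cong (_+ (g (suc n) - h (suc n))) (Σ≤-- n g h))
  (interchange (Σ≤ n g) (Σ≤ n h) (g (suc n)) (h (suc n)))
  where
  interchange : ∀ a b c d → a - b + (c - d) ≡ a + c - (b + d)
  interchange = solve-∀

Σ≤-*ˡ : ∀ n c (g : ℕ → ℤ) → Σ≤ n (λ i → c * g i) ≡ c * Σ≤ n g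
Σ≤-*ˡ zero    c g = refl
Σ≤-*ˡ (suc n) c g =
  trans (cong (_+ c * g (suc n)) (Σ≤-*ˡ n c g)) (sym (ℤₚ.*-distribˡ-+ c (Σ≤ n g) (g (suc n))))

Σ≤-zero : ∀ n {g : ℕ → ℤ} → (∀ i → i ≤ n → g i ≡ + 0) → Σ≤ n g ≡ + 0
Σ≤-zero zero    g≡0 = g≡0 0 z≤n
Σ≤-zero (suc n) g≡0 =
  cong₂ _+_ (Σ≤-zero n λ i i≤n → g≡0 i (ℕₚ.m≤n⇒m≤1+n i≤n)) (g≡0 (suc n) ℕₚ.≤-refl)

Σ≤-suc : ∀ n (g : ℕ → ℤ) → Σ≤ (suc n) g ≡ g 0 + Σ≤ n (g ∘ suc)
Σ≤-suc zero    g = refl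
Σ≤-suc (suc n) g = trans (cong (_+ g (suc (suc n))) (Σ≤-suc n g)) (ℤₚ.+-assoc (g 0) _ _)

Σ≤-extend : ∀ {n N} (g : ℕ → ℤ) → n ≤′ N → (∀ i → n < i → i ≤ N → g i ≡ + 0) →
            Σ≤ N g ≡ Σ≤ n g
Σ≤-extend g ≤′-refl          g≡0 = refl
Σ≤-extend g (≤′-step {N} n≤N) g≡0 = trans
  (cong₂ _+_ (Σ≤-extend g n≤N λ i n<i i≤N → g≡0 i n<i (ℕₚ.m≤n⇒m≤1+n i≤N))
             (g≡0 (suc N) (s≤s (ℕₚ.≤′⇒≤ n≤N)) ℕₚ.≤-refl))
  (ℤₚ.+-identityʳ _)

Σ≤-last : ∀ n (g : ℕ → ℤ) → (∀ i → i < n → g i ≡ + 0) → Σ≤ n g ≡ g n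
Σ≤-last zero    g g≡0 = refl
Σ≤-last (suc n) g g≡0 =
  trans (cong (_+ g (suc n)) (Σ≤-zero n λ i i≤n → g≡0 i (s≤s i≤n))) (ℤₚ.+-identityˡ _)

Σ≤-single : ∀ {d n} (g : ℕ → ℤ) → d ≤ n → (∀ i → i ≤ n → ¬ i ≡ d → g i ≡ + 0) → Σ≤ n g ≡ g d
Σ≤-single {d} g d≤n g≡0 = trans
  (Σ≤-extend g (ℕₚ.≤⇒≤′ d≤n) λ i d<i i≤n → g≡0 i i≤n λ { refl → ℕₚ.<-irrefl refl d<i })
  (Σ≤-last d g λ i i<d → g≡0 i (ℕₚ.<⇒≤ (ℕₚ.<-≤-trans i<d d≤n)) λ { refl → ℕₚ.<-irrefl refl i<d })

infix  4 _≈_ _≈[>_]_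
infixr 7 _·ˢ_ ⟨1+_x²⟩·_ ⟨1+_x²⟩^_·_

_≈_ : Series → Series → Set
A ≈ B = ∀ n → A n ≡ B n

_≈[>_]_ : Series → ℕ → Series → Set
A ≈[> e ] B = ∀ n → e < n → A n ≡ B n

_·ˢ_ : ℤ → Series → Series
(c ·ˢ A) n = c * A n

shift : Series → Series
shift A zero    = + 0
shift A (suc n) = A n

shift^ : ℕ → Series → Series
shift^ zero    A = A
shift^ (suc k) A = shift (shift^ k A)

⟨1+_x²⟩·_ : ℤ → Series → Series
⟨1+ c x²⟩· A = A ⊕ (c ·ˢ shift (shift A))

⟨1+_x²⟩^_·_ : ℤ → ℕ → Series → Series
⟨1+ c x²⟩^ zero  · A = A
⟨1+ c x²⟩^ suc k · A = ⟨1+ c x²⟩· ⟨1+ c x²⟩^ k · A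

shift-cong : ∀ {A B} → A ≈ B → shift A ≈ shift B
shift-cong A≈B zero    = refl
shift-cong A≈B (suc n) = A≈B n

shift^-cong : ∀ k {A B} → A ≈ B → shift^ k A ≈ shift^ k B
shift^-cong zero    A≈B = A≈B
shift^-cong (suc k) A≈B = shift-cong (shift^-cong k A≈B)

shift^-shift : ∀ k A → shift^ k (shift A) ≈ shift (shift^ k A)
shift^-shift zero    A n = refl
shift^-shift (suc k) A   = shift-cong (shift^-shift k A)

shift^-≥ : ∀ {d n} A → d ≤ n → shift^ d A n ≡ A (n ∸ d)
shift^-≥ {zero}              A z≤n       = refl
shift^-≥ {suc d} {suc n} A (s≤s d≤n) = shift^-≥ A d≤n

shift^-< : ∀ {d n} A → n < d → shift^ d A n ≡ + 0
shift^-< {suc d} {zero}  A n<d       = refl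
shift^-< {suc d} {suc n} A (s≤s n<d) = shift^-< A n<d

⟨1+x²⟩-cong : ∀ c {A B} → A ≈ B → ⟨1+ c x²⟩· A ≈ ⟨1+ c x²⟩· B
⟨1+x²⟩-cong c A≈B n = cong₂ _+_ (A≈B n) (cong (c *_) (shift-cong (shift-cong A≈B) n))

⟨1+x²⟩-shift : ∀ c A → ⟨1+ c x²⟩· shift A ≈ shift (⟨1+ c x²⟩· A)
⟨1+x²⟩-shift c A zero    = trans (ℤₚ.+-identityˡ _) (ℤₚ.*-zeroʳ c)
⟨1+x²⟩-shift c A (suc n) = refl

⟨1+x²⟩-shift^ : ∀ c k A → ⟨1+ c x²⟩· shift^ k A ≈ shift^ k (⟨1+ c x²⟩· A)
⟨1+x²⟩-shift^ c zero    A n = refl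
⟨1+x²⟩-shift^ c (suc k) A n =
  trans (⟨1+x²⟩-shift c (shift^ k A) n) (shift-cong (⟨1+x²⟩-shift^ c k A) n)

shift-resp-≈[>] : ∀ {e A B} → A ≈[> e ] B → shift A ≈[> suc e ] shift B
shift-resp-≈[>] A≈B (suc n) (s≤s e<n) = A≈B n e<n

shift^-resp-≈[>] : ∀ k {e A B} → A ≈[> e ] B → shift^ k A ≈[> k ℕ.+ e ] shift^ k B
shift^-resp-≈[>] zero    A≈B = A≈B
shift^-resp-≈[>] (suc k) A≈B = shift-resp-≈[>] (shift^-resp-≈[>] k A≈B)

⟨1+x²⟩-resp-≈[>] : ∀ c {e A B} → A ≈[> e ] B → ⟨1+ c x²⟩· A ≈[> 2 ℕ.+ e ] ⟨1+ c x²⟩· B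
⟨1+x²⟩-resp-≈[>] c A≈B (suc (suc n)) (s≤s (s≤s e<n)) =
  cong₂ _+_ (A≈B (suc (suc n)) (ℕₚ.m<n⇒m<1+n (ℕₚ.m<n⇒m<1+n e<n))) (cong (c *_) (A≈B n e<n))

⊛-congˡ : ∀ {a a′} b → a ≈ a′ → a ⊛ b ≈ a′ ⊛ b
⊛-congˡ b a≈a′ n = Σ≤-cong n λ i _ → cong (_* b (n ∸ i)) (a≈a′ i)

⊛-congʳ : ∀ a {b b′} → b ≈ b′ → a ⊛ b ≈ a ⊛ b′
⊛-congʳ a b≈b′ n = Σ≤-cong n λ i _ → cong (a i *_) (b≈b′ (n ∸ i))

⊛-distribʳ-⊕ : ∀ a b c → (a ⊕ b) ⊛ c ≈ (a ⊛ c) ⊕ (b ⊛ c)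
⊛-distribʳ-⊕ a b c n = trans (Σ≤-cong n λ i _ → ℤₚ.*-distribʳ-+ (c (n ∸ i)) (a i) (b i)) (Σ≤-+ n _ _)

⊛-distribˡ-⊕ : ∀ a b c → a ⊛ (b ⊕ c) ≈ (a ⊛ b) ⊕ (a ⊛ c)
⊛-distribˡ-⊕ a b c n = trans (Σ≤-cong n λ i _ → ℤₚ.*-distribˡ-+ (a i) _ _) (Σ≤-+ n _ _)

⊛-distribˡ-⊖ : ∀ a b c → a ⊛ (b ⊖ c) ≈ (a ⊛ b) ⊖ (a ⊛ c)
⊛-distribˡ-⊖ a b c n = trans (Σ≤-cong n λ i _ → distrib (a i) _ _) (Σ≤-- n _ _)
  where
  distrib : ∀ x y z → x * (y - z) ≡ x * y - x * z
  distrib = solve-∀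

⊛-·ˢʳ : ∀ a c b → a ⊛ (c ·ˢ b) ≈ c ·ˢ (a ⊛ b)
⊛-·ˢʳ a c b n = trans (Σ≤-cong n λ i _ → swap (a i) c _) (Σ≤-*ˡ n c _)
  where
  swap : ∀ x y z → x * (y * z) ≡ y * (x * z)
  swap = solve-∀

⊛-identityʳ : ∀ a → a ⊛ one ≈ a
⊛-identityʳ a n = trans (Σ≤-single {n} _ ℕₚ.≤-refl vanish)
  (trans (cong (λ k → a n * one k) (ℕₚ.n∸n≡0 n)) (ℤₚ.*-identityʳ (a n)))
  where
  one-pos : ∀ k → 0 < k → one k ≡ + 0
  one-pos (suc k) _ = refl
  vanish : ∀ i → i ≤ n → ¬ i ≡ n → a i * one (n ∸ i) ≡ + 0
  vanish i i≤n i≢n = trans (cong (a i *_) (one-pos (n ∸ i) (ℕₚ.m<n⇒0<n∸m (ℕₚ.≤∧≢⇒< i≤n i≢n))))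
                           (ℤₚ.*-zeroʳ (a i))

⊛-shiftʳ : ∀ a b → a ⊛ shift b ≈ shift (a ⊛ b)
⊛-shiftʳ a b zero    = ℤₚ.*-zeroʳ (a 0)
⊛-shiftʳ a b (suc n) = trans
  (cong₂ _+_ (Σ≤-cong n λ i i≤n → cong (λ k → a i * shift b k) (ℕₚ.+-∸-assoc 1 i≤n))
             (trans (cong (λ k → a (suc n) * shift b k) (ℕₚ.n∸n≡0 n)) (ℤₚ.*-zeroʳ (a (suc n)))))
  (ℤₚ.+-identityʳ _)

⊛-shift^ʳ : ∀ k a b → a ⊛ shift^ k b ≈ shift^ k (a ⊛ b)
⊛-shift^ʳ zero    a b n = refl
⊛-shift^ʳ (suc k) a b n = trans (⊛-shiftʳ a (shift^ k b) n) (shift-cong (⊛-shift^ʳ k a b) n)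

⊛-⟨1+x²⟩ʳ : ∀ c a b → a ⊛ (⟨1+ c x²⟩· b) ≈ ⟨1+ c x²⟩· (a ⊛ b)
⊛-⟨1+x²⟩ʳ c a b n = trans (⊛-distribˡ-⊕ a b (c ·ˢ shift (shift b)) n)
  (cong (λ z → (a ⊛ b) n + z) (trans (⊛-·ˢʳ a c (shift (shift b)) n) (cong (c *_) (⊛-shift^ʳ 2 a b n))))

mono-≡ : ∀ c d → mono c d d ≡ c
mono-≡ c d = cong (if_then c else + 0) (dec-true (d ℕ.≟ d) refl)

mono-≢ : ∀ c {d i} → ¬ i ≡ d → mono c d i ≡ + 0
mono-≢ c {d} {i} i≢d = cong (if_then c else + 0) (dec-false (i ℕ.≟ d) i≢d)

mono-⊛ : ∀ c d b → mono c d ⊛ b ≈ c ·ˢ shift^ d b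
mono-⊛ c d b n with d ℕₚ.≤? n
... | yes d≤n = trans
  (Σ≤-single _ d≤n λ i _ i≢d →
    trans (cong (_* b (n ∸ i)) (mono-≢ c {d} {i} i≢d)) (ℤₚ.*-zeroˡ (b (n ∸ i))))
  (cong₂ _*_ (mono-≡ c d) (sym (shift^-≥ b d≤n)))
... | no d≰n = trans
  (Σ≤-zero n λ i i≤n → trans (cong (_* b (n ∸ i))
    (mono-≢ c {d} {i} λ { refl → d≰n i≤n })) (ℤₚ.*-zeroˡ (b (n ∸ i))))
  (sym (trans (cong (c *_) (shift^-< b (ℕₚ.≰⇒> d≰n))) (ℤₚ.*-zeroʳ c)))

one≈mono : one ≈ mono (+ 1) 0
one≈mono zero    = refl
one≈mono (suc n) = refl

mono≈shift^one : ∀ d → mono (+ 1) d ≈ shift^ d one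
mono≈shift^one zero    zero    = refl
mono≈shift^one zero    (suc n) = refl
mono≈shift^one (suc d) zero    = refl
mono≈shift^one (suc d) (suc n) = mono≈shift^one d n

one-⊛ : ∀ b → one ⊛ b ≈ b
one-⊛ b n = trans (⊛-congˡ b one≈mono n) (trans (mono-⊛ (+ 1) 0 b n) (ℤₚ.*-identityˡ (b n)))

[1+cx²]-⊛ : ∀ c b → (one ⊕ mono c 2) ⊛ b ≈ ⟨1+ c x²⟩· b
[1+cx²]-⊛ c b n = trans (⊛-distribʳ-⊕ one (mono c 2) b n) (cong₂ _+_ (one-⊛ b n) (mono-⊛ c 2 b n))

⊛-[1+cx²]^ʳ : ∀ c k a → a ⊛ ((one ⊕ mono c 2) ^ˢ k) ≈ ⟨1+ c x²⟩^ k · a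
⊛-[1+cx²]^ʳ c zero    a n = ⊛-identityʳ a n
⊛-[1+cx²]^ʳ c (suc k) a n = trans (⊛-congʳ a ([1+cx²]-⊛ c ((one ⊕ mono c 2) ^ˢ k)) n)
  (trans (⊛-⟨1+x²⟩ʳ c a ((one ⊕ mono c 2) ^ˢ k) n) (⟨1+x²⟩-cong c (⊛-[1+cx²]^ʳ c k a) n))

⊛-monoʳ : ∀ d a → a ⊛ mono (+ 1) d ≈ shift^ d a
⊛-monoʳ d a n = trans (⊛-congʳ a (mono≈shift^one d) n)
  (trans (⊛-shift^ʳ d a one n) (shift^-cong d (⊛-identityʳ a) n))

polyDeg≤-⊛-denominator : ∀ c k {d} a → ⟨1+ c x²⟩^ k · a ≈[> d ] shift^ k a →
  PolyDeg≤ (a ⊛ (((one ⊕ mono c 2) ^ˢ k) ⊖ mono (+ 1) k)) d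
polyDeg≤-⊛-denominator c k a agree n d<n = begin
  (a ⊛ (((one ⊕ mono c 2) ^ˢ k) ⊖ mono (+ 1) k)) n
    ≡⟨ ⊛-distribˡ-⊖ a ((one ⊕ mono c 2) ^ˢ k) (mono (+ 1) k) n ⟩
  (a ⊛ ((one ⊕ mono c 2) ^ˢ k)) n - (a ⊛ mono (+ 1) k) n
    ≡⟨ cong₂ _-_ (⊛-[1+cx²]^ʳ c k a n) (⊛-monoʳ k a n) ⟩
  (⟨1+ c x²⟩^ k · a) n - shift^ k a n
    ≡⟨ cong (_- shift^ k a n) (agree n d<n) ⟩
  shift^ k a n - shift^ k a n
    ≡⟨ ℤₚ.+-inverseʳ (shift^ k a n) ⟩
  + 0 ∎
  where open ≡-Reasoning

telescope : ∀ c (F : ℕ → Series) e →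
  (∀ a → ⟨1+ c x²⟩· ⟨1+ c x²⟩· F a ≈[> e ] shift (shift (F (suc a)))) →
  ∀ i → ⟨1+ c x²⟩^ 2 ℕ.* suc i · F 0 ≈[> 4 ℕ.* i ℕ.+ e ] shift^ (2 ℕ.* suc i) (F (suc i))
telescope c F e step zero = step 0
telescope c F e step (suc i) n bound = begin
  (⟨1+ c x²⟩^ 2 ℕ.* suc (suc i) · F 0) n
    ≡⟨ cong (λ k → (⟨1+ c x²⟩^ k · F 0) n) (ℕₚ.*-suc 2 (suc i)) ⟩
  (⟨1+ c x²⟩· ⟨1+ c x²⟩· ⟨1+ c x²⟩^ K · F 0) n
    ≡⟨ ⟨1+x²⟩-resp-≈[>] c (⟨1+x²⟩-resp-≈[>] c (telescope c F e step i)) n bound₁ ⟩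
  (⟨1+ c x²⟩· ⟨1+ c x²⟩· shift^ K (F (suc i))) n
    ≡⟨ trans (⟨1+x²⟩-cong c (⟨1+x²⟩-shift^ c K _) n) (⟨1+x²⟩-shift^ c K _ n) ⟩
  shift^ K (⟨1+ c x²⟩· ⟨1+ c x²⟩· F (suc i)) n
    ≡⟨ shift^-resp-≈[>] K (step (suc i)) n bound₂ ⟩
  shift^ K (shift (shift (F (suc (suc i))))) n
    ≡⟨ trans (shift^-shift K _ n) (shift-cong (shift^-shift K _) n) ⟩
  shift^ (2 ℕ.+ K) (F (suc (suc i))) n
    ≡⟨ cong (λ k → shift^ k (F (suc (suc i))) n) (sym (ℕₚ.*-suc 2 (suc i))) ⟩
  shift^ (2 ℕ.* suc (suc i)) (F (suc (suc i))) n ∎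
  where
  open ≡-Reasoning
  K = 2 ℕ.* suc i
  bound₁ : 4 ℕ.+ (4 ℕ.* i ℕ.+ e) < n
  bound₁ = subst (λ b → b ℕ.+ e < n) (ℕₚ.*-suc 4 i) bound
  bound₂ : K ℕ.+ e < n
  bound₂ = ℕₚ.≤-<-trans (ℕₚ.+-monoˡ-≤ e (ℕₚ.*-monoˡ-≤ (suc i) {2} {4} (s≤s (s≤s z≤n)))) bound

0+x*0+x*0≡0 : ∀ x → (+ 0 + x * + 0) + x * + 0 ≡ + 0
0+x*0+x*0≡0 = solve-∀

0+x*0+x*[0+x*0]≡0 : ∀ x → (+ 0 + x * + 0) + x * (+ 0 + x * + 0) ≡ + 0
0+x*0+x*[0+x*0]≡0 = solve-∀

module Coefficients (Q : ℤ) (r m : ℕ) where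

  selected : ℕ → ℕ → Bool
  selected T j = does (m ∣? ∣ + T - + r - + j ∣)

  term : ℕ → ℕ → ℕ → ℤ
  term k T j = if selected T j then + ((k ∸ j) C j) * ((- Q) ^ j) else + 0

  -- f_{r,m,k} is f′ k ⌊k/2⌋ when Q = q (the terms with j > ⌊k/2⌋ vanish)
  f′ : ℕ → ℕ → ℤ
  f′ k T = Σ≤ k (term k T)

  divisible-+m : ∀ z → does (m ∣? ∣ z + + m ∣) ≡ does (m ∣? ∣ z ∣)
  divisible-+m z = does-⇔ (mk⇔
    (λ m∣z+m → ℤ∣.∣⇒∣ᵤ (ℤ∣.∣m+n∣n⇒∣m {+ m} {z} (ℤ∣.∣ᵤ⇒∣ {+ m} {z + + m} m∣z+m) ℤ∣.∣-refl))
    (λ m∣z → ℤ∣.∣⇒∣ᵤ {+ m} (ℤ∣.∣m∣n⇒∣m+n (ℤ∣.∣ᵤ⇒∣ {+ m} {z} m∣z) ℤ∣.∣-refl)))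
    (m ∣? ∣ z + + m ∣) (m ∣? ∣ z ∣)

  selected-suc : ∀ T j → selected (suc T) (suc j) ≡ selected T j
  selected-suc T j = cong (λ z → does (m ∣? ∣ z ∣)) (begin
    + suc T - + r - + suc j           ≡⟨ cong₂ (λ x y → x - + r - y) (ℤₚ.pos-+ 1 T) (ℤₚ.pos-+ 1 j) ⟩
    (+ 1 + + T) - + r - (+ 1 + + j)   ≡⟨ cancel (+ 1) (+ T) (+ r) (+ j) ⟩
    + T - + r - + j                   ∎)
    where
    open ≡-Reasoning
    cancel : ∀ o t s j → (o + t) - s - (o + j) ≡ t - s - j
    cancel = solve-∀

  selected-periodic : ∀ T j → selected (T ℕ.+ m) j ≡ selected T j
  selected-periodic T j = trans
    (cong (λ z → does (m ∣? ∣ z ∣))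
      (trans (cong (λ x → x - + r - + j) (ℤₚ.pos-+ T m)) (move (+ T) (+ m) (+ r) (+ j))))
    (divisible-+m (+ T - + r - + j))
    where
    move : ∀ t n s j → t + n - s - j ≡ t - s - j + n
    move = solve-∀

  term-vanish : ∀ k T j → (k ∸ j) C j ≡ 0 → term k T j ≡ + 0
  term-vanish k T j C≡0 with selected T j
  ... | true  = trans (cong (λ c → + c * ((- Q) ^ j)) C≡0) (ℤₚ.*-zeroˡ ((- Q) ^ j))
  ... | false = refl

  term-pascal : ∀ k T j → j ≤ k →
    term (2 ℕ.+ k) (suc T) (suc j) ≡ term (suc k) (suc T) (suc j) + (- Q) * term k T j
  term-pascal k T j j≤k
    rewrite selected-suc T j | ℕₚ.+-∸-assoc 1 j≤k | sym (nCk+nC[k+1]≡[n+1]C[k+1] (k ∸ j) j)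
    with selected T j
  ... | true  = trans (cong (_* ((- Q) * (- Q) ^ j)) (sym (ℤₚ.pos-+ ((k ∸ j) C j) ((k ∸ j) C suc j))))
                      (regroup (+ ((k ∸ j) C j)) (+ ((k ∸ j) C suc j)) (- Q) ((- Q) ^ j))
    where
    regroup : ∀ a b c p → (a + b) * (c * p) ≡ b * (c * p) + c * (a * p)
    regroup = solve-∀
  ... | false = sym (trans (ℤₚ.+-identityˡ _) (ℤₚ.*-zeroʳ (- Q)))

  f′-pascal : ∀ k T → f′ (2 ℕ.+ k) (suc T) ≡ f′ (suc k) (suc T) + (- Q) * f′ k T
  f′-pascal k T = begin
    f′ (2 ℕ.+ k) (suc T)
      ≡⟨ Σ≤-suc (suc k) t₂ ⟩
    t₂ 0 + (Σ≤ k (t₂ ∘ suc) + t₂ (2 ℕ.+ k))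
      ≡⟨ cong (λ z → t₂ 0 + (Σ≤ k (t₂ ∘ suc) + z)) (term-vanish (2 ℕ.+ k) (suc T) (2 ℕ.+ k) top) ⟩
    t₂ 0 + (Σ≤ k (t₂ ∘ suc) + + 0)
      ≡⟨ cong (λ z → t₂ 0 + z) (trans (ℤₚ.+-identityʳ _) (Σ≤-cong k λ j j≤k → term-pascal k T j j≤k)) ⟩
    t₁ 0 + Σ≤ k (λ j → t₁ (suc j) + (- Q) * term k T j)
      ≡⟨ cong (λ z → t₁ 0 + z) (trans (Σ≤-+ k _ _) (cong (λ z → Σ≤ k (t₁ ∘ suc) + z) (Σ≤-*ˡ k (- Q) _))) ⟩
    t₁ 0 + (Σ≤ k (t₁ ∘ suc) + (- Q) * f′ k T)
      ≡⟨ sym (ℤₚ.+-assoc (t₁ 0) _ _) ⟩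
    t₁ 0 + Σ≤ k (t₁ ∘ suc) + (- Q) * f′ k T
      ≡⟨ cong (_+ (- Q) * f′ k T) (sym (Σ≤-suc k t₁)) ⟩
    f′ (suc k) (suc T) + (- Q) * f′ k T ∎
    where
    open ≡-Reasoning
    t₂ = term (2 ℕ.+ k) (suc T)
    t₁ = term (suc k) (suc T)
    top : (2 ℕ.+ k ∸ (2 ℕ.+ k)) C (2 ℕ.+ k) ≡ 0
    top = k>n⇒nCk≡0 (subst (_< 2 ℕ.+ k) (sym (ℕₚ.n∸n≡0 k)) (s≤s z≤n))

  f′-1 : ∀ T → f′ 1 T ≡ f′ 0 T
  f′-1 T = trans (cong (λ z → term 0 T 0 + z) (term-vanish 1 T 1 refl)) (ℤₚ.+-identityʳ _)

  f′-periodic : ∀ k T → f′ k (T ℕ.+ m) ≡ f′ k T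
  f′-periodic k T = Σ≤-cong k λ j _ →
    cong (λ b → if b then + ((k ∸ j) C j) * ((- Q) ^ j) else + 0) (selected-periodic T j)

  -- the left side is the coefficient of (1 + Q x²)² at degree k + 4 of a series with
  -- coefficients g₀, g₂, g₄ at degrees k, k + 2, k + 4
  pascal³ : ∀ {g₄ g₃ g₂ g₂′ g₁ g₀} →
    g₄ ≡ g₃ + (- Q) * g₂ → g₃ ≡ g₂′ + (- Q) * g₁ → g₂ ≡ g₁ + (- Q) * g₀ →
    (g₄ + Q * g₂) + Q * (g₂ + Q * g₀) ≡ g₂′
  pascal³ {g₂′ = g₂′} {g₁} {g₀} refl refl refl = cancel g₂′ g₁ g₀ Q
    where
    cancel : ∀ a b d x →
      a + - x * b + - x * (b + - x * d) + x * (b + - x * d) + x * (b + - x * d + x * d) ≡ a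
    cancel = solve-∀

  genF′ : ℕ → ℕ → Series
  genF′ δ a n = if does (n % 2 ℕ.≟ δ) then f′ n (⌊ n /2⌋ ℕ.+ a) else + 0

  genF′-step : ∀ δ a →
    ⟨1+ Q x²⟩· ⟨1+ Q x²⟩· genF′ δ a ≈[> 2 ∸ δ ] shift (shift (genF′ δ (suc a)))
  genF′-step zero          a 0 ()
  genF′-step zero          a 1 (s≤s ())
  genF′-step zero          a 2 (s≤s (s≤s ()))
  genF′-step zero          a 3 _ = 0+x*0+x*[0+x*0]≡0 Q
  genF′-step (suc zero)    a 0 ()
  genF′-step (suc zero)    a 1 (s≤s ())
  genF′-step (suc zero)    a 2 _ = 0+x*0+x*[0+x*0]≡0 Q
  genF′-step (suc zero)    a 3 _ = pascal³ (f′-pascal 1 a) (f′-pascal 0 a)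
    (trans (f′-1 a) (sym (trans (cong (λ z → f′ 0 a + z) (ℤₚ.*-zeroʳ (- Q))) (ℤₚ.+-identityʳ _))))
  genF′-step (suc (suc δ)) a 0 ()
  genF′-step (suc (suc δ)) a 1 _ = 0+x*0+x*0≡0 Q
  genF′-step (suc (suc δ)) a 2 _ = 0+x*0+x*[0+x*0]≡0 Q
  genF′-step (suc (suc δ)) a 3 _ = 0+x*0+x*[0+x*0]≡0 Q
  genF′-step δ a (suc (suc (suc (suc n)))) _ with does (n % 2 ℕ.≟ δ)
  ... | false = 0+x*0+x*[0+x*0]≡0 Q
  ... | true  rewrite ℕₚ.+-suc ⌊ n /2⌋ a = pascal³
    (f′-pascal (2 ℕ.+ n) (suc (⌊ n /2⌋ ℕ.+ a))) (f′-pascal (suc n) (suc (⌊ n /2⌋ ℕ.+ a)))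
    (f′-pascal n (⌊ n /2⌋ ℕ.+ a))

  genF′-periodic : ∀ δ a → genF′ δ (a ℕ.+ m) ≈ genF′ δ a
  genF′-periodic δ a n = cong (λ z → if does (n % 2 ℕ.≟ δ) then z else + 0)
    (trans (cong (f′ n) (sym (ℕₚ.+-assoc ⌊ n /2⌋ a m))) (f′-periodic n (⌊ n /2⌋ ℕ.+ a)))

f≡f′ : ∀ q r m k → f q r m k ≡ Coefficients.f′ (+ q) r m k (⌊ k /2⌋ ℕ.+ 0)
f≡f′ q r m k = begin
  f q r m k
    ≡⟨ sym (Σ≤-extend (term k K) (ℕₚ.≤⇒≤′ (ℕₚ.⌊n/2⌋≤n k)) vanish) ⟩
  Σ≤ k (term k K)
    ≡⟨ cong (λ T → Σ≤ k (term k T)) (sym (ℕₚ.+-identityʳ K)) ⟩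
  f′ k (K ℕ.+ 0) ∎
  where
  open ≡-Reasoning
  open Coefficients (+ q) r m
  K = ⌊ k /2⌋
  k<j+j : ∀ {j} → K < j → k < j ℕ.+ j
  k<j+j {j} K<j = ℕₚ.≰⇒> λ j+j≤k →
    ℕₚ.<⇒≱ K<j (subst (_≤ K) (sym (ℕₚ.n≡⌊n+n/2⌋ j)) (ℕₚ.⌊n/2⌋-mono j+j≤k))
  vanish : ∀ j → K < j → j ≤ k → term k K j ≡ + 0
  vanish (suc j) K<j _ = term-vanish k K (suc j) (k>n⇒nCk≡0 (ℕₚ.m<n+o⇒m∸n<o k (suc j) (k<j+j K<j)))

genF≈genF′ : ∀ q r m δ → genF q r m δ ≈ Coefficients.genF′ (+ q) r m δ 0
genF≈genF′ q r m δ n = cong (λ z → if does (n % 2 ℕ.≟ δ) then z else + 0) (f≡f′ q r m n)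

4m∸2∸δ≡ : ∀ m′ {δ} → δ ≤ 2 → 4 ℕ.* suc m′ ∸ 2 ∸ δ ≡ 4 ℕ.* m′ ℕ.+ (2 ∸ δ)
4m∸2∸δ≡ m′ {δ} δ≤2 = begin
  4 ℕ.* suc m′ ∸ 2 ∸ δ     ≡⟨ cong (λ x → x ∸ 2 ∸ δ) (ℕₚ.*-suc 4 m′) ⟩
  (2 ℕ.+ 4 ℕ.* m′) ∸ δ     ≡⟨ ℕₚ.+-∸-comm (4 ℕ.* m′) δ≤2 ⟩
  (2 ∸ δ) ℕ.+ 4 ℕ.* m′     ≡⟨ ℕₚ.+-comm (2 ∸ δ) _ ⟩
  4 ℕ.* m′ ℕ.+ (2 ∸ δ)     ∎
  where open ≡-Reasoning

lemma3p10 : (q : ℕ) → IsPrimePower q → (δ m r : ℕ) → δ ≤ 1 → 1 ≤ m → r < m →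
    ∃ λ (h : Series) → PolyDeg≤ h (4 ℕ.* m ∸ 2 ∸ δ) ×
      (∀ n → (genF q r m δ ⊛ denom q m) n ≡ h n)
lemma3p10 q _ δ zero     r _   ()  _
lemma3p10 q _ δ (suc m′) r δ≤1 _ _ = genF q r m δ ⊛ denom q m , degree , λ _ → refl
  where
  open Coefficients (+ q) r (suc m′)
  m = suc m′
  agree : ⟨1+ + q x²⟩^ 2 ℕ.* m · genF′ δ 0 ≈[> 4 ℕ.* m′ ℕ.+ (2 ∸ δ) ] shift^ (2 ℕ.* m) (genF′ δ 0)
  agree n bound = trans (telescope (+ q) (genF′ δ) (2 ∸ δ) (genF′-step δ) m′ n bound)
                        (shift^-cong (2 ℕ.* m) (genF′-periodic δ 0) n)
  degree : PolyDeg≤ (genF q r m δ ⊛ denom q m) (4 ℕ.* m ∸ 2 ∸ δ)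
  degree n bound = trans (⊛-congˡ (denom q m) (genF≈genF′ q r m δ) n)
    (polyDeg≤-⊛-denominator (+ q) (2 ℕ.* m) (genF′ δ 0) agree n
      (subst (_< n) (4m∸2∸δ≡ m′ (ℕₚ.m≤n⇒m≤1+n δ≤1)) bound))
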